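{- In infinite Wordle with words of length $\omega$ over an alphabet $\Sigma$ and a dictionary $\Delta\subseteq{}^\omega\Sigma$ that is countable (and nonempty), the codebreaker has a strategy that always wins at a finite stage of play, i.e., for every codeword $w\in\Delta$ there is $n<\omega$ such that the $n$th guess equals $w$.
   Context: Infinite Wordle: alphabet $\Sigma$, nonempty dictionary $\Delta\subseteq{}^\omega\Sigma$ of allowed codewords and guesswords. A hidden codeword $w\in\Delta$ is fixed and the codebreaker places guesswords $s_0,s_1,\dots\in\Delta$, receiving after each guess $s$ Wordle feedback: position $i$ is green if $s(i)=w(i)$; among the non-green positions of $s$ carrying letter $a$, the first $k$ are yellow where $k$ is the number of non-green positions $j$ with $w(j)=a$; the rest are gray. A strategy chooses each guess as a function of the feedback on earlier guesses. -}

module Defs where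

open import Data.Nat using (ℕ; zero; suc)
open import Data.List using (List; []; _∷_; _++_)
open import Data.Product using (Σ; ∃; _×_; _,_)
open import Relation.Nullary using (¬_)
open import Relation.Binary.PropositionalEquality using (_≡_; _≢_)

Word : Set → Set
Word A = ℕ → A

-- Equality of ω-words (pointwise; no function extensionality in Agda).
_≈w_ : {A : Set} → Word A → Word A → Set
u ≈w v = ∀ i → u i ≡ v i

data Count (P : ℕ → Set) : ℕ → ℕ → Set where
  c-zero : Count P zero zero
  c-yes  : ∀ {i m} → Count P i m → P i → Count P (suc i) (suc m)
  c-no   : ∀ {i m} → Count P i m → ¬ P i → Count P (suc i) m

AtLeast : (ℕ → Set) → ℕ → Set
AtLeast P k = ∃ λ n → Count P n k

data Color : Set where
  green yellow gray : Color

module _ {A : Set} (w s : Word A) where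
  NonGreen : ℕ → Set
  NonGreen j = s j ≢ w j

  GuessLetter : A → ℕ → Set
  GuessLetter a j = NonGreen j × s j ≡ a

  CodeLetter : A → ℕ → Set
  CodeLetter a j = NonGreen j × w j ≡ a

  -- Wordle colour of position i of guess s against codeword w:
  -- green iff s i = w i; otherwise, if m non-green positions before i carry
  -- the letter s i, position i is yellow iff there are at least m+1
  -- non-green positions of w carrying s i (i.e. it is among the first k,
  -- k the possibly infinite number of such positions), else gray.
  data ColorAt (i : ℕ) : Color → Set where
    is-green  : s i ≡ w i → ColorAt i green
    is-yellow : NonGreen i → (m : ℕ) → Count (GuessLetter (s i)) i m →
                AtLeast (CodeLetter (s i)) (suc m) → ColorAt i yellow
    is-gray   : NonGreen i → (m : ℕ) → Count (GuessLetter (s i)) i m →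
                ¬ AtLeast (CodeLetter (s i)) (suc m) → ColorAt i gray

Feedback : Set
Feedback = ℕ → Color

IsFeedback : {A : Set} → Word A → Word A → Feedback → Set
IsFeedback w s f = ∀ i → ColorAt w s i (f i)

CountableNonempty : {A : Set} → (Word A → Set) → Set
CountableNonempty {A} Δ =
  Σ (ℕ → Word A) λ e → (∀ n → Δ (e n)) × (∀ w → Δ w → ∃ λ n → e n ≈w w)

-- A strategy: next guess as a function of the feedback on earlier guesses
-- (oldest first); every guess must lie in the dictionary.
Strategy : {A : Set} → (Word A → Set) → Set
Strategy {A} Δ = Σ (List Feedback → Word A) λ σ → ∀ h → Δ (σ h)

history : (ℕ → Feedback) → ℕ → List Feedback
history f zero = []
history f (suc n) = history f n ++ (f n ∷ [])

IsPlay : {A : Set} → (List Feedback → Word A) → Word A →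
         (ℕ → Word A) → (ℕ → Feedback) → Set
IsPlay σ w g fb = ∀ n → (g n ≡ σ (history fb n)) × IsFeedback w (g n) (fb n)

AlwaysWinsFinitely : {A : Set} (Δ : Word A → Set) → Strategy Δ → Set
AlwaysWinsFinitely {A} Δ (σ , _) =
  ∀ (w : Word A) → Δ w → ∀ (g : ℕ → Word A) (fb : ℕ → Feedback) →
  IsPlay σ w g fb → ∃ λ n → g n ≈w w

-- A countable dictionary can simply be enumerated: guessing the n-th word of
-- the enumeration at stage n, regardless of the feedback, reaches every
-- codeword w ∈ Δ at the index where the enumeration hits w.
module Submission where

open import Defs
open import Data.Nat using (ℕ; zero; suc; _+_)
open import Data.Nat.Properties using (+-comm)
open import Data.List using (length; [_]; _++_)
open import Data.List.Properties using (length-++)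
open import Data.Product using (Σ; _,_; proj₁)
open import Relation.Binary.PropositionalEquality using (_≡_; refl; cong; trans; module ≡-Reasoning)

length-history : (fb : ℕ → Feedback) (n : ℕ) → length (history fb n) ≡ n
length-history fb zero = refl
length-history fb (suc n) = begin
  length (history fb n ++ [ fb n ])        ≡⟨ length-++ (history fb n) ⟩
  length (history fb n) + length [ fb n ]  ≡⟨ +-comm (length (history fb n)) 1 ⟩
  suc (length (history fb n))              ≡⟨ cong suc (length-history fb n) ⟩
  suc n                                    ∎
  where open ≡-Reasoning

module _ {A : Set} (Δ : Word A → Set) (e : ℕ → Word A) (e∈Δ : ∀ n → Δ (e n)) where

  enumerationStrategy : Strategy Δ
  enumerationStrategy = (λ h → e (length h)) , (λ h → e∈Δ (length h))

  enumerationStrategy-guess : ∀ {w g fb} → IsPlay (proj₁ enumerationStrategy) w g fb →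
                              ∀ n → g n ≡ e n
  enumerationStrategy-guess play n = trans (proj₁ (play n)) (cong e (length-history _ n))

  enumerationStrategy-wins : (∀ w → Δ w → Σ ℕ λ n → e n ≈w w) →
                             AlwaysWinsFinitely Δ enumerationStrategy
  enumerationStrategy-wins onto w w∈Δ g fb play with onto w w∈Δ
  ... | n , en≈w = n , λ i → trans (cong (λ u → u i) (enumerationStrategy-guess play n)) (en≈w i)

mainTheorem3 : (A : Set) (Δ : Word A → Set) → CountableNonempty Δ →
    Σ (Strategy Δ) (AlwaysWinsFinitely Δ)
mainTheorem3 A Δ (e , e∈Δ , onto) =
  enumerationStrategy Δ e e∈Δ , enumerationStrategy-wins Δ e e∈Δ onto
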